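{- For any integers $k\geq m\geq 1$ and $n\geq l\geq k+1$, the number $op_{n,k,=l}^{m}$ of ordered preference sets $(a_1,\dots,a_n)$ of length $n$ with exactly $k$ flaws, leading term $a_1=m$ and $\max_i a_i=l$ equals $$\frac{(n-l+2k-m+4)(n-m+k+1)-(l-k-2)}{(n-m+k+2)(n+l-m-1)}\binom{n+l-m-1}{l-k-2}.$$
   Context: Parking model: $n$ parking spaces numbered $1,\dots,n$ from left to right; a preference set of length $n$ is a sequence $(a_1,\dots,a_n)$ with $a_i\in[n]$. Cars arrive in order; car $i$ goes to space $a_i$, and if it is occupied, moves to the first unoccupied space to the right; if there is none, the car cannot park. The number of flaws is the number of cars that cannot park. A preference set is ordered if $a_1\leq\cdots\leq a_n$; its leading term is $a_1$. Binomial coefficients with negative lower index are $0$. -}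

module Defs where

open import Data.Nat using (ℕ; zero; suc; _∸_; _≤_; _≤?_; _⊔_; _≡ᵇ_)
open import Data.Nat.Properties using (_≟_)
open import Data.Nat.Combinatorics using (_C_)
open import Data.Integer using (ℤ; +_; -[1+_])
open import Data.Bool using (Bool; true; false; if_then_else_)
open import Data.Bool.ListAction using (any)
open import Data.List using (List; []; _∷_; [_]; map; concatMap; upTo; foldr; head; filter; length)
open import Data.List.Relation.Unary.Linked using (Linked; linked?)
open import Data.Maybe using (Maybe; just; nothing)
import Data.Maybe.Properties as MaybeP
open import Data.Product using (_×_)
open import Relation.Nullary using (Dec)
open import Relation.Nullary.Decidable using (_×-dec_)
open import Relation.Binary.PropositionalEquality using (_≡_)

-- Parking spaces are 1..n.  `occ` is the list of occupied spaces.
-- firstFree occ s f : first unoccupied space among s, s+1, ..., s+f-1.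
firstFree : List ℕ → ℕ → ℕ → Maybe ℕ
firstFree occ s zero = nothing
firstFree occ s (suc f) =
  if any (λ t → t ≡ᵇ s) occ then firstFree occ (suc s) f else just s

-- Park the cars in order; count those that cannot park.
-- Car preferring a searches spaces a, a+1, ..., n  (n - a + 1 spaces).
flawsFrom : ℕ → List ℕ → List ℕ → ℕ
flawsFrom n occ [] = 0
flawsFrom n occ (a ∷ as) with firstFree occ a (suc n ∸ a)
... | nothing = suc (flawsFrom n occ as)
... | just s  = flawsFrom n (s ∷ occ) as

flaws : ℕ → List ℕ → ℕ
flaws n as = flawsFrom n [] as

prefSeqs : ℕ → ℕ → List (List ℕ)
prefSeqs n zero = [ [] ]
prefSeqs n (suc len) =
  concatMap (λ a → map (a ∷_) (prefSeqs n len)) (map suc (upTo n))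

prefSets : ℕ → List (List ℕ)
prefSets n = prefSeqs n n

maxList : List ℕ → ℕ
maxList = foldr _⊔_ 0

Counted : ℕ → ℕ → ℕ → ℕ → List ℕ → Set
Counted n k m l as =
  Linked _≤_ as × flaws n as ≡ k × head as ≡ just m × maxList as ≡ l

counted? : ∀ n k m l (as : List ℕ) → Dec (Counted n k m l as)
counted? n k m l as =
  linked? _≤?_ as ×-dec (flaws n as ≟ k) ×-dec
  (MaybeP.≡-dec _≟_ (head as) (just m)) ×-dec (maxList as ≟ l)

op : ℕ → ℕ → ℕ → ℕ → ℕ
op n k m l = length (filter (counted? n k m l) (prefSets n))

binomℤ : ℕ → ℤ → ℤ
binomℤ a (+ b) = + (a C b)
binomℤ a -[1+ _ ] = + 0

module Submission where

-- For an ordered preference set the parking process is transparent: each car takes the larger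
-- of its preference and one plus the last space taken so far, so the flaws are exactly the cars
-- that would park beyond space n on an infinite street.  Having leading term m, at most h flaws
-- and maximum at most L thus means that the remaining n - 1 terms form a weakly increasing
-- sequence in [m, L] staying below a line of slope one, and such sequences are counted by the
-- ballot numbers C(d + r, r) - C(d + r, r + e + 1) (reflection principle).  Inclusion-exclusion
-- over "at most k flaws" and "maximum at most l" gives op = C(p + b, p) - C(p + b, p + 1) with
-- p = n - m + k and b = l - k - 2, which is (p + 1 - b) / (p + b + 1) · C(p + b + 1, b).

open import Defs

module Indicators where

  open import Data.Bool.Base using (Bool; true; false; _∧_)
  open import Data.List.Base using (List; []; _∷_; _++_; map; concatMap; filter; length; applyUpTo; upTo)
  open import Data.List.Properties using (map-applyUpTo)
  open import Data.Nat.Base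
  open import Data.Nat.Properties
  open import Data.Nat.Tactic.RingSolver using (solve-∀)
  open import Function.Base using (_∘_)
  open import Level using (Level)
  open import Relation.Nullary.Decidable using (does; dec-true; dec-false)
  open import Relation.Unary using (Pred; Decidable)
  open import Relation.Binary.Definitions using (tri<; tri≈; tri>)
  open import Relation.Binary.PropositionalEquality
  open import Relation.Nullary using (yes; no)

  𝟙 : Bool → ℕ
  𝟙 true  = 1
  𝟙 false = 0

  ≤ᵇ-true : ∀ {m n} → m ≤ n → (m ≤ᵇ n) ≡ true
  ≤ᵇ-true {m} {n} = dec-true (m ≤? n)

  ≤ᵇ-false : ∀ {m n} → n < m → (m ≤ᵇ n) ≡ false
  ≤ᵇ-false {m} {n} n<m = dec-false (m ≤? n) (<⇒≱ n<m)

  ≤ᵇ-cong : ∀ {a b c d} → (a ≤ b → c ≤ d) → (c ≤ d → a ≤ b) → (a ≤ᵇ b) ≡ (c ≤ᵇ d)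
  ≤ᵇ-cong {a} {b} to from with a ≤? b
  ... | yes a≤b = trans (≤ᵇ-true a≤b) (sym (≤ᵇ-true (to a≤b)))
  ... | no  a≰b = trans (≤ᵇ-false (≰⇒> a≰b)) (sym (≤ᵇ-false (≰⇒> (a≰b ∘ from))))

  ≡ᵇ-true : ∀ {m n} → m ≡ n → (m ≡ᵇ n) ≡ true
  ≡ᵇ-true {m} {n} = dec-true (m ≟ n)

  ≡ᵇ-false : ∀ {m n} → m ≢ n → (m ≡ᵇ n) ≡ false
  ≡ᵇ-false {m} {n} = dec-false (m ≟ n)

  ⊔-≤ᵇ : ∀ b c L → (b ⊔ c ≤ᵇ L) ≡ (b ≤ᵇ L) ∧ (c ≤ᵇ L)
  ⊔-≤ᵇ b c L with b ≤? L | c ≤? L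
  ... | yes b≤L | yes c≤L rewrite ≤ᵇ-true b≤L | ≤ᵇ-true c≤L = ≤ᵇ-true (⊔-lub b≤L c≤L)
  ... | no  b≰L | _       rewrite ≤ᵇ-false (≰⇒> b≰L) = ≤ᵇ-false (<-≤-trans (≰⇒> b≰L) (m≤m⊔n b c))
  ... | yes b≤L | no  c≰L rewrite ≤ᵇ-true b≤L | ≤ᵇ-false (≰⇒> c≰L) =
    ≤ᵇ-false (<-≤-trans (≰⇒> c≰L) (m≤n⊔m b c))

  ∸-≤ᵇ : ∀ x n h → (x ∸ n ≤ᵇ h) ≡ (x ≤ᵇ n + h)
  ∸-≤ᵇ x n h = ≤ᵇ-cong (λ x-n≤h → ≤-trans (m≤n+m∸n x n) (+-monoʳ-≤ n x-n≤h)) (m≤n+o⇒m∸n≤o x n)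

  ⊔-+-≤ᵇ : ∀ b c r N → c + r ≤ N → (b ⊔ c + r ≤ᵇ N) ≡ (b ≤ᵇ N ∸ r)
  ⊔-+-≤ᵇ b c r N c+r≤N = ≤ᵇ-cong
    (λ b⊔c+r≤N → m+n≤o⇒m≤o∸n b (≤-trans (+-monoˡ-≤ r (m≤m⊔n b c)) b⊔c+r≤N))
    (λ b≤N-r → subst (_≤ N) (sym (+-distribʳ-⊔ r b c))
                 (⊔-lub (m≤o∸n⇒m+n≤o b (m+n≤o⇒n≤o c c+r≤N) b≤N-r) c+r≤N))

  m≤n⇒[m≡ᵇn]≡[n≤ᵇm] : ∀ {m n} → m ≤ n → (m ≡ᵇ n) ≡ (n ≤ᵇ m)
  m≤n⇒[m≡ᵇn]≡[n≤ᵇm] {m} {n} m≤n with m ≟ n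
  ... | yes m≡n = trans (≡ᵇ-true m≡n) (sym (≤ᵇ-true (≤-reflexive (sym m≡n))))
  ... | no  m≢n = trans (≡ᵇ-false m≢n) (sym (≤ᵇ-false (≤∧≢⇒< m≤n m≢n)))

  𝟙-∧ : ∀ a b → 𝟙 (a ∧ b) ≡ 𝟙 a * 𝟙 b
  𝟙-∧ true  b = sym (+-identityʳ (𝟙 b))
  𝟙-∧ false b = refl

  𝟙-≤ᵇ-suc : ∀ f k → 𝟙 (f ≤ᵇ suc k) ≡ 𝟙 (f ≡ᵇ suc k) + 𝟙 (f ≤ᵇ k)
  𝟙-≤ᵇ-suc f k with <-cmp f (suc k)
  ... | tri< f<k+1 f≢k+1 _ rewrite ≤ᵇ-true (<⇒≤ f<k+1) | ≡ᵇ-false f≢k+1 | ≤ᵇ-true (s≤s⁻¹ f<k+1) = refl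
  ... | tri≈ _ refl _
    rewrite ≤ᵇ-true (≤-refl {suc k}) | ≡ᵇ-true (refl {x = suc k}) | ≤ᵇ-false (≤-refl {suc k}) = refl
  ... | tri> _ f≢k+1 k+1<f rewrite ≤ᵇ-false k+1<f | ≡ᵇ-false f≢k+1 | ≤ᵇ-false (<⇒≤ k+1<f) = refl

  ∑ : {A : Set} → (A → ℕ) → List A → ℕ
  ∑ f []       = 0
  ∑ f (x ∷ xs) = f x + ∑ f xs

  private
    variable
      A B : Set

  ∑-cong : {f g : A → ℕ} → (∀ x → f x ≡ g x) → ∀ xs → ∑ f xs ≡ ∑ g xs
  ∑-cong f≗g []       = refl
  ∑-cong f≗g (x ∷ xs) = cong₂ _+_ (f≗g x) (∑-cong f≗g xs)

  ∑-++ : ∀ (f : A → ℕ) xs ys → ∑ f (xs ++ ys) ≡ ∑ f xs + ∑ f ys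
  ∑-++ f []       ys = refl
  ∑-++ f (x ∷ xs) ys = trans (cong (f x +_) (∑-++ f xs ys)) (sym (+-assoc (f x) _ _))

  ∑-concatMap : ∀ (f : B → ℕ) (g : A → List B) xs →
                ∑ f (concatMap g xs) ≡ ∑ (λ x → ∑ f (g x)) xs
  ∑-concatMap f g []       = refl
  ∑-concatMap f g (x ∷ xs) =
    trans (∑-++ f (g x) (concatMap g xs)) (cong (∑ f (g x) +_) (∑-concatMap f g xs))

  ∑-map : ∀ (f : B → ℕ) (g : A → B) xs → ∑ f (map g xs) ≡ ∑ (f ∘ g) xs
  ∑-map f g []       = refl
  ∑-map f g (x ∷ xs) = cong (f (g x) +_) (∑-map f g xs)

  *-distribˡ-∑ : ∀ c (f : A → ℕ) xs → c * ∑ f xs ≡ ∑ (λ x → c * f x) xs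
  *-distribˡ-∑ c f []       = *-zeroʳ c
  *-distribˡ-∑ c f (x ∷ xs) =
    trans (*-distribˡ-+ c (f x) _) (cong (c * f x +_) (*-distribˡ-∑ c f xs))

  ∑-distrib-+ : ∀ (f g : A → ℕ) xs → ∑ (λ x → f x + g x) xs ≡ ∑ f xs + ∑ g xs
  ∑-distrib-+ f g []       = refl
  ∑-distrib-+ f g (x ∷ xs) =
    trans (cong (f x + g x +_) (∑-distrib-+ f g xs)) (interchange (f x) (g x) _ _)
    where
    interchange : ∀ a b c d → a + b + (c + d) ≡ a + c + (b + d)
    interchange = solve-∀

  length-filter≡∑𝟙 : ∀ {p : Level} {P : Pred A p} (P? : Decidable P) xs →
                     length (filter P? xs) ≡ ∑ (λ x → 𝟙 (does (P? x))) xs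
  length-filter≡∑𝟙 P? []       = refl
  length-filter≡∑𝟙 P? (x ∷ xs) with does (P? x)
  ... | true  = cong suc (length-filter≡∑𝟙 P? xs)
  ... | false = length-filter≡∑𝟙 P? xs

  ∑₁ : ℕ → (ℕ → ℕ) → ℕ
  ∑₁ zero    F = 0
  ∑₁ (suc n) F = F 1 + ∑₁ n (F ∘ suc)

  ∑₁-cong : ∀ n {F G : ℕ → ℕ} → (∀ i → F (suc i) ≡ G (suc i)) → ∑₁ n F ≡ ∑₁ n G
  ∑₁-cong zero    F≗G = refl
  ∑₁-cong (suc n) F≗G = cong₂ _+_ (F≗G 0) (∑₁-cong n (F≗G ∘ suc))

  ∑₁-zero : ∀ n {F : ℕ → ℕ} → (∀ i → F (suc i) ≡ 0) → ∑₁ n F ≡ 0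
  ∑₁-zero zero    F≗0 = refl
  ∑₁-zero (suc n) F≗0 = cong₂ _+_ (F≗0 0) (∑₁-zero n (F≗0 ∘ suc))

  ∑-applyUpTo : ∀ (F g : ℕ → ℕ) n → ∑ F (applyUpTo (g ∘ suc) n) ≡ ∑₁ n (F ∘ g)
  ∑-applyUpTo F g zero    = refl
  ∑-applyUpTo F g (suc n) = cong (F (g 1) +_) (∑-applyUpTo F (g ∘ suc) n)

  ∑-prefSeqs-suc : ∀ n r (f : List ℕ → ℕ) →
                   ∑ f (prefSeqs n (suc r)) ≡ ∑₁ n (λ a → ∑ (λ as → f (a ∷ as)) (prefSeqs n r))
  ∑-prefSeqs-suc n r f = begin
    ∑ f (concatMap (λ a → map (a ∷_) (prefSeqs n r)) (map suc (upTo n)))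
      ≡⟨ ∑-concatMap f (λ a → map (a ∷_) (prefSeqs n r)) (map suc (upTo n)) ⟩
    ∑ (λ a → ∑ f (map (a ∷_) (prefSeqs n r))) (map suc (upTo n))
      ≡⟨ cong (∑ _) (map-applyUpTo (λ i → i) suc n) ⟩
    ∑ (λ a → ∑ f (map (a ∷_) (prefSeqs n r))) (applyUpTo suc n)
      ≡⟨ ∑-applyUpTo _ (λ a → a) n ⟩
    ∑₁ n (λ a → ∑ f (map (a ∷_) (prefSeqs n r)))
      ≡⟨ ∑₁-cong n (λ i → ∑-map f _ (prefSeqs n r)) ⟩
    ∑₁ n (λ a → ∑ (λ as → f (a ∷ as)) (prefSeqs n r)) ∎
    where open ≡-Reasoning

  ∑₁-from : ∀ n w (F : ℕ → ℕ) → 1 ≤ w → w ≤ n →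
            ∑₁ n (λ b → 𝟙 (w ≤ᵇ b) * F b) ≡ F w + ∑₁ n (λ b → 𝟙 (suc w ≤ᵇ b) * F b)
  ∑₁-from (suc n) 1 F _ _ =
    cong₂ _+_ (*-identityˡ (F 1)) (∑₁-cong n (λ i → refl))
  ∑₁-from (suc n) (suc (suc w)) F _ (s≤s w<n) = ∑₁-from n (suc w) (F ∘ suc) (s≤s z≤n) w<n

  ∑₁-pointMass : ∀ n w (F : ℕ → ℕ) → 1 ≤ w → w ≤ n → ∑₁ n (λ b → 𝟙 (w ≡ᵇ b) * F b) ≡ F w
  ∑₁-pointMass (suc n) 1 F _ _ =
    trans (cong₂ _+_ (*-identityˡ (F 1)) (∑₁-zero n (λ i → refl))) (+-identityʳ (F 1))
  ∑₁-pointMass (suc n) (suc (suc w)) F _ (s≤s w<n) = ∑₁-pointMass n (suc w) (F ∘ suc) (s≤s z≤n) w<n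

  ∑between : ℕ → ℕ → ℕ → (ℕ → ℕ) → ℕ
  ∑between n w L F = ∑₁ n (λ b → 𝟙 (w ≤ᵇ b) * (𝟙 (b ≤ᵇ L) * F b))

  module _ (n w L : ℕ) where

    ∑between-cong : {F G : ℕ → ℕ} → (∀ b → w ≤ b → b ≤ L → F b ≡ G b) → ∑between n w L F ≡ ∑between n w L G
    ∑between-cong {F} {G} F≗G = ∑₁-cong n (λ i → guarded (suc i))
      where
      guarded : ∀ b → 𝟙 (w ≤ᵇ b) * (𝟙 (b ≤ᵇ L) * F b) ≡ 𝟙 (w ≤ᵇ b) * (𝟙 (b ≤ᵇ L) * G b)
      guarded b with w ≤? b | b ≤? L
      ... | yes w≤b | yes b≤L = cong (λ x → 𝟙 (w ≤ᵇ b) * (𝟙 (b ≤ᵇ L) * x)) (F≗G b w≤b b≤L)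
      ... | no  w≰b | _       rewrite ≤ᵇ-false (≰⇒> w≰b) = refl
      ... | yes _   | no  b≰L rewrite ≤ᵇ-false (≰⇒> b≰L) = refl

    ∑between-zero : {F : ℕ → ℕ} → (∀ b → w ≤ b → b ≤ L → F b ≡ 0) → ∑between n w L F ≡ 0
    ∑between-zero F≗0 = trans (∑between-cong F≗0) (∑₁-zero n (λ i → zeroʳ (suc i)))
      where
      zeroʳ : ∀ b → 𝟙 (w ≤ᵇ b) * (𝟙 (b ≤ᵇ L) * 0) ≡ 0
      zeroʳ b = trans (cong (𝟙 (w ≤ᵇ b) *_) (*-zeroʳ (𝟙 (b ≤ᵇ L)))) (*-zeroʳ (𝟙 (w ≤ᵇ b)))

module OrderedParking where

  open import Data.Bool.ListAction using (any)
  open import Data.Bool.Properties using (∨-zeroʳ; ∨-identityʳ)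
  open import Data.List.Base using (List; []; _∷_)
  open import Data.List.Relation.Unary.Linked using (Linked; _∷_)
  open import Data.Maybe.Base using (just; nothing)
  open import Data.Nat.Base
  open import Data.Nat.Properties
  open import Relation.Binary.PropositionalEquality
  open import Data.Sum.Base using (inj₁; inj₂)
  open import Relation.Nullary using (yes; no; contradiction)
  open Indicators using (≤ᵇ-true; ≤ᵇ-false; m≤n⇒[m≡ᵇn]≡[n≤ᵇm])

  -- The last space taken on an infinite street by ordered cars arriving after spaces up to q.
  lastSpace : ℕ → List ℕ → ℕ
  lastSpace q []       = q
  lastSpace q (b ∷ bs) = lastSpace (b ⊔ suc q) bs

  q≤lastSpace : ∀ q bs → q ≤ lastSpace q bs
  q≤lastSpace q []       = ≤-refl
  q≤lastSpace q (b ∷ bs) = ≤-trans (n≤1+n q) (≤-trans (m≤n⊔m b (suc q)) (q≤lastSpace (b ⊔ suc q) bs))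

  lastSpace-suc : ∀ q bs → maxList bs ≤ q → lastSpace (suc q) bs ≡ suc (lastSpace q bs)
  lastSpace-suc q []       _     = refl
  lastSpace-suc q (b ∷ bs) max≤q
    rewrite m≤n⇒m⊔n≡n (m≤n⇒m≤1+n (m⊔n≤o⇒m≤o b _ max≤q))
          | m≤n⇒m⊔n≡n (m≤n⇒m≤1+n (m≤n⇒m≤1+n (m⊔n≤o⇒m≤o b _ max≤q)))
          = lastSpace-suc (suc q) bs (≤-trans (m⊔n≤o⇒n≤o b _ max≤q) (n≤1+n q))

  OccupiedUpTo : List ℕ → ℕ → ℕ → Set
  OccupiedUpTo occ w q = ∀ t → w ≤ t → any (λ u → u ≡ᵇ t) occ ≡ (t ≤ᵇ q)

  module _ {occ w q} (occupied : OccupiedUpTo occ w q) where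

    firstFree-found : ∀ f s → w ≤ s → s ⊔ suc q < s + f → firstFree occ s f ≡ just (s ⊔ suc q)
    firstFree-found zero s _ s⊔q<s+0 =
      contradiction (≤-trans s⊔q<s+0 (≤-reflexive (+-identityʳ s))) (≤⇒≯ (m≤m⊔n s (suc q)))
    firstFree-found (suc f) s w≤s s⊔q<s+f with s ≤? q
    ... | yes s≤q rewrite occupied s w≤s | ≤ᵇ-true s≤q =
      trans (firstFree-found f (suc s) (m≤n⇒m≤1+n w≤s) (subst₂ _<_ s⊔q≡1+s⊔q (+-suc s f) s⊔q<s+f))
            (cong just (sym s⊔q≡1+s⊔q))
      where
      s⊔q≡1+s⊔q : s ⊔ suc q ≡ suc s ⊔ suc q
      s⊔q≡1+s⊔q = trans (m≤n⇒m⊔n≡n (m≤n⇒m≤1+n s≤q)) (sym (cong suc (m≤n⇒m⊔n≡n s≤q)))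
    ... | no s≰q rewrite occupied s w≤s | ≤ᵇ-false (≰⇒> s≰q) =
      cong just (sym (m≥n⇒m⊔n≡m (≰⇒> s≰q)))

    firstFree-full : ∀ f s → w ≤ s → s + f ≤ suc q → firstFree occ s f ≡ nothing
    firstFree-full zero s _ _ = refl
    firstFree-full (suc f) s w≤s s+f≤q with ≤-trans (≤-reflexive (sym (+-suc s f))) s+f≤q
    ... | 1+s+f≤q rewrite occupied s w≤s | ≤ᵇ-true (s≤s⁻¹ (≤-trans (s≤s (m≤m+n s f)) 1+s+f≤q)) =
      firstFree-full f (suc s) (m≤n⇒m≤1+n w≤s) 1+s+f≤q

    occupied-park : ∀ b → w ≤ b → OccupiedUpTo ((b ⊔ suc q) ∷ occ) b (b ⊔ suc q)
    occupied-park b w≤b t b≤t rewrite occupied t (≤-trans w≤b b≤t) with t ≤? q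
    ... | yes t≤q rewrite ≤ᵇ-true t≤q =
      trans (∨-zeroʳ _) (sym (≤ᵇ-true (≤-trans (m≤n⇒m≤1+n t≤q) (m≤n⊔m b (suc q)))))
    ... | no t≰q rewrite ≤ᵇ-false (≰⇒> t≰q) =
      trans (∨-identityʳ _) (m≤n⇒[m≡ᵇn]≡[n≤ᵇm] (⊔-lub b≤t (≰⇒> t≰q)))

    occupied-mono : ∀ {w′} → w ≤ w′ → OccupiedUpTo occ w′ q
    occupied-mono w≤w′ t w′≤t = occupied t (≤-trans w≤w′ w′≤t)

  occupied-single : ∀ m → OccupiedUpTo (m ∷ []) m m
  occupied-single m t m≤t = trans (∨-identityʳ _) (m≤n⇒[m≡ᵇn]≡[n≤ᵇm] m≤t)

  flawsFrom-parks : ∀ n occ b bs {s} → firstFree occ b (suc n ∸ b) ≡ just s →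
                    flawsFrom n occ (b ∷ bs) ≡ flawsFrom n (s ∷ occ) bs
  flawsFrom-parks n occ b bs found rewrite found = refl

  flawsFrom-fails : ∀ n occ b bs → firstFree occ b (suc n ∸ b) ≡ nothing →
                    flawsFrom n occ (b ∷ bs) ≡ suc (flawsFrom n occ bs)
  flawsFrom-fails n occ b bs full rewrite full = refl

  flawsFrom-ordered : ∀ n {occ w q} as → OccupiedUpTo occ w q → q ≤ n →
                      Linked _≤_ (w ∷ as) → maxList as ≤ n → flawsFrom n occ as ≡ lastSpace q as ∸ n
  flawsFrom-ordered n []       _        q≤n _ _ = sym (m≤n⇒m∸n≡0 q≤n)
  flawsFrom-ordered n {occ} {q = q} (b ∷ bs) occupied q≤n (w≤b ∷ sorted) max≤n
    with m⊔n≤o⇒m≤o b _ max≤n | m⊔n≤o⇒n≤o b _ max≤n | m≤n⇒m<n∨m≡n q≤n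
  ... | b≤n | bs≤n | inj₁ q<n =
    trans (flawsFrom-parks n occ b bs (firstFree-found occupied (suc n ∸ b) b w≤b b⊔q<b+[n+1-b]))
          (flawsFrom-ordered n bs (occupied-park {occ = occ} occupied b w≤b) (⊔-lub b≤n q<n) sorted bs≤n)
    where
    b⊔q<b+[n+1-b] : b ⊔ suc q < b + (suc n ∸ b)
    b⊔q<b+[n+1-b] = subst (b ⊔ suc q <_) (sym (m+[n∸m]≡n (m≤n⇒m≤1+n b≤n))) (s≤s (⊔-lub b≤n q<n))
  ... | b≤n | bs≤n | inj₂ refl = begin
    flawsFrom n occ (b ∷ bs)
      ≡⟨ flawsFrom-fails n occ b bs (firstFree-full occupied (suc n ∸ b) b w≤b b+[n+1-b]≤n+1) ⟩
    suc (flawsFrom n occ bs)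
      ≡⟨ cong suc (flawsFrom-ordered n bs (occupied-mono {occ = occ} occupied w≤b) ≤-refl sorted bs≤n) ⟩
    suc (lastSpace n bs ∸ n)
      ≡⟨ +-∸-assoc 1 (q≤lastSpace n bs) ⟨
    suc (lastSpace n bs) ∸ n
      ≡⟨ cong (_∸ n) (lastSpace-suc n bs bs≤n) ⟨
    lastSpace (suc n) bs ∸ n
      ≡⟨ cong (λ q′ → lastSpace q′ bs ∸ n) (m≤n⇒m⊔n≡n (m≤n⇒m≤1+n b≤n)) ⟨
    lastSpace (b ⊔ suc n) bs ∸ n ∎
    where
    open ≡-Reasoning
    b+[n+1-b]≤n+1 : b + (suc n ∸ b) ≤ suc n
    b+[n+1-b]≤n+1 = ≤-reflexive (m+[n∸m]≡n (m≤n⇒m≤1+n b≤n))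

  flaws-ordered : ∀ n m as → m ≤ n → Linked _≤_ (m ∷ as) → maxList as ≤ n →
                  flaws n (m ∷ as) ≡ lastSpace m as ∸ n
  flaws-ordered n m as m≤n sorted max≤n =
    trans (flawsFrom-parks n [] m as (cong (firstFree [] m) (+-∸-assoc 1 m≤n)))
          (flawsFrom-ordered n as (occupied-single m) m≤n sorted max≤n)

module Binomial where

  open import Data.Nat.Base
  open import Data.Nat.Properties
  open import Data.Nat.Combinatorics using (_C_; nC1≡n; k>n⇒nCk≡0; nCk+nC[k+1]≡[n+1]C[k+1])
  open import Data.Nat.Tactic.RingSolver using (solve-∀)
  open import Relation.Binary.PropositionalEquality

  pascal : ∀ n k → suc n C suc k ≡ n C k + n C suc k
  pascal n k = sym (nCk+nC[k+1]≡[n+1]C[k+1] n k)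

  [1+k]*[1+n]C[1+k]≡[1+n]*nCk : ∀ n k → suc k * (suc n C suc k) ≡ suc n * (n C k)
  [1+k]*[1+n]C[1+k]≡[1+n]*nCk zero zero = refl
  [1+k]*[1+n]C[1+k]≡[1+n]*nCk zero (suc k)
    rewrite k>n⇒nCk≡0 {1} {suc (suc k)} (s≤s (s≤s z≤n)) | k>n⇒nCk≡0 {0} {suc k} (s≤s z≤n) =
    *-zeroʳ (suc (suc k))
  [1+k]*[1+n]C[1+k]≡[1+n]*nCk (suc n) zero
    rewrite nC1≡n (suc (suc n)) = trans (+-identityʳ (suc (suc n))) (sym (*-identityʳ (suc (suc n))))
  [1+k]*[1+n]C[1+k]≡[1+n]*nCk (suc n) (suc k) = begin
    suc (suc k) * (suc (suc n) C suc (suc k))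
      ≡⟨ cong (suc (suc k) *_) (pascal (suc n) (suc k)) ⟩
    suc (suc k) * (suc n C suc k + suc n C suc (suc k))
      ≡⟨ expand (suc k) (suc n C suc k) (suc n C suc (suc k)) ⟩
    suc k * (suc n C suc k) + suc n C suc k + suc (suc k) * (suc n C suc (suc k))
      ≡⟨ cong₂ (λ u v → u + suc n C suc k + v)
               ([1+k]*[1+n]C[1+k]≡[1+n]*nCk n k) ([1+k]*[1+n]C[1+k]≡[1+n]*nCk n (suc k)) ⟩
    suc n * (n C k) + suc n C suc k + suc n * (n C suc k)
      ≡⟨ cong (λ u → suc n * (n C k) + u + suc n * (n C suc k)) (pascal n k) ⟩
    suc n * (n C k) + (n C k + n C suc k) + suc n * (n C suc k)
      ≡⟨ collect n (n C k) (n C suc k) ⟩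
    suc (suc n) * (n C k + n C suc k)
      ≡⟨ cong (suc (suc n) *_) (pascal n k) ⟨
    suc (suc n) * (suc n C suc k) ∎
    where
    open ≡-Reasoning
    expand : ∀ j a b → suc j * (a + b) ≡ j * a + a + suc j * b
    expand = solve-∀
    collect : ∀ n a b → suc n * a + (a + b) + suc n * b ≡ suc (suc n) * (a + b)
    collect = solve-∀

  [1+t]*[t+b]C[1+t]≡b*[t+b]Ct : ∀ t b → suc t * ((t + b) C suc t) ≡ b * ((t + b) C t)
  [1+t]*[t+b]C[1+t]≡b*[t+b]Ct t b = +-cancelˡ-≡ (suc t * X) _ _ (begin
    suc t * X + suc t * ((t + b) C suc t) ≡⟨ *-distribˡ-+ (suc t) X _ ⟨
    suc t * (X + (t + b) C suc t)         ≡⟨ cong (suc t *_) (pascal (t + b) t) ⟨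
    suc t * (suc (t + b) C suc t)         ≡⟨ [1+k]*[1+n]C[1+k]≡[1+n]*nCk (t + b) t ⟩
    suc (t + b) * X                       ≡⟨ *-distribʳ-+ X (suc t) b ⟩
    suc t * X + b * X                     ∎)
    where
    open ≡-Reasoning
    X : ℕ
    X = (t + b) C t

module Ballot where

  open import Data.Nat.Base
  open import Data.Nat.Properties
  open import Data.Nat.Combinatorics using (_C_; nCn≡1; k>n⇒nCk≡0)
  open import Data.Nat.Tactic.RingSolver using (solve-∀)
  open import Relation.Binary.PropositionalEquality
  open import Relation.Nullary using (contradiction)
  open Indicators
  open Binomial using (pascal)

  -- ballot r d e is the number of sequences 0 ≤ x₁ ≤ ⋯ ≤ x_r ≤ d with x_i < e + i;
  -- the recursion splits on whether x₁ = 0.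
  ballot : ℕ → ℕ → ℕ → ℕ
  ballot zero    d       e       = 1
  ballot (suc r) zero    e       = ballot r zero (suc e)
  ballot (suc r) (suc d) zero    = ballot r (suc d) 1
  ballot (suc r) (suc d) (suc e) = ballot r (suc d) (suc (suc e)) + ballot (suc r) d e

  module _ (n r L E : ℕ) (L≤n : L ≤ n) where

    private
      summand : ℕ → ℕ
      summand b = 𝟙 (b ≤ᵇ L) * (𝟙 (b ≤ᵇ E) * ballot r (L ∸ b) (suc E ∸ b))

      summand-first : ∀ w → w ≤ L → w ≤ E → summand w ≡ ballot r (L ∸ w) (suc (E ∸ w))
      summand-first w w≤L w≤E rewrite ≤ᵇ-true w≤L | ≤ᵇ-true w≤E | +-∸-assoc 1 w≤E =
        trans (*-identityˡ _) (*-identityˡ _)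

      first-step : ∀ d w → L ∸ w ≡ d → 1 ≤ w → w ≤ L → w ≤ E →
                   ∑₁ n (λ b → 𝟙 (w ≤ᵇ b) * summand b) ≡ ballot (suc r) d (E ∸ w)
      first-step d w L-w≡d 1≤w w≤L w≤E =
        trans (∑₁-from n w summand 1≤w (≤-trans w≤L L≤n)) (split d (E ∸ w) L-w≡d refl)
        where
        rest : ℕ
        rest = ∑₁ n (λ b → 𝟙 (suc w ≤ᵇ b) * summand b)
        split : ∀ d e → L ∸ w ≡ d → E ∸ w ≡ e → summand w + rest ≡ ballot (suc r) d e
        split zero e L-w≡0 E-w≡e = begin
          summand w + rest
            ≡⟨ cong₂ _+_ (summand-first w w≤L w≤E) (∑between-zero n (suc w) L beyond-L) ⟩
          ballot r (L ∸ w) (suc (E ∸ w)) + 0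
            ≡⟨ cong₂ (λ d e → ballot r d (suc e) + 0) L-w≡0 E-w≡e ⟩
          ballot r 0 (suc e) + 0
            ≡⟨ +-identityʳ _ ⟩
          ballot (suc r) 0 e ∎
          where
          open ≡-Reasoning
          beyond-L : ∀ b → suc w ≤ b → b ≤ L → 𝟙 (b ≤ᵇ E) * ballot r (L ∸ b) (suc E ∸ b) ≡ 0
          beyond-L b w<b b≤L = contradiction (≤-trans w<b b≤L) (≤⇒≯ (m∸n≡0⇒m≤n L-w≡0))
        split (suc d) zero L-w≡d E-w≡0 = begin
          summand w + rest
            ≡⟨ cong₂ _+_ (summand-first w w≤L w≤E) (∑between-zero n (suc w) L beyond-E) ⟩
          ballot r (L ∸ w) (suc (E ∸ w)) + 0
            ≡⟨ cong₂ (λ d e → ballot r d (suc e) + 0) L-w≡d E-w≡0 ⟩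
          ballot r (suc d) 1 + 0
            ≡⟨ +-identityʳ _ ⟩
          ballot (suc r) (suc d) 0 ∎
          where
          open ≡-Reasoning
          beyond-E : ∀ b → suc w ≤ b → b ≤ L → 𝟙 (b ≤ᵇ E) * ballot r (L ∸ b) (suc E ∸ b) ≡ 0
          beyond-E b w<b _ rewrite ≤ᵇ-false (≤-trans (s≤s (m∸n≡0⇒m≤n E-w≡0)) w<b) = refl
        split (suc d) (suc e) L-w≡d E-w≡e = begin
          summand w + rest
            ≡⟨ cong₂ _+_ (summand-first w w≤L w≤E)
                         (first-step d (suc w) (pred-∸ L-w≡d) (s≤s z≤n) (∸≡suc⇒< L-w≡d) (∸≡suc⇒< E-w≡e)) ⟩
          ballot r (L ∸ w) (suc (E ∸ w)) + ballot (suc r) d (E ∸ suc w)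
            ≡⟨ cong₂ _+_ (cong₂ (λ d′ e′ → ballot r d′ (suc e′)) L-w≡d E-w≡e)
                         (cong (ballot (suc r) d) (pred-∸ E-w≡e)) ⟩
          ballot (suc r) (suc d) (suc e) ∎
          where
          open ≡-Reasoning
          pred-∸ : ∀ {m k} → m ∸ w ≡ suc k → m ∸ suc w ≡ k
          pred-∸ {m} eq = trans (sym (pred[m∸n]≡m∸[1+n] m w)) (cong pred eq)
          ∸≡suc⇒< : ∀ {m k} → m ∸ w ≡ suc k → w < m
          ∸≡suc⇒< {m} eq = ≰⇒> (λ m≤w → 0≢1+n (trans (sym (m≤n⇒m∸n≡0 m≤w)) eq))

    ballot-firstStep : ∀ w → 1 ≤ w → w ≤ L → w ≤ E →
      ∑between n w L (λ b → 𝟙 (b ≤ᵇ E) * ballot r (L ∸ b) (suc E ∸ b))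
        ≡ ballot (suc r) (L ∸ w) (E ∸ w)
    ballot-firstStep w = first-step (L ∸ w) w refl

  private
    interchange : ∀ a b x y → a + b + (x + y) ≡ (a + y) + (b + x)
    interchange = solve-∀

    rotate : ∀ a x y → a + (x + y) ≡ (a + y) + x
    rotate = solve-∀

  -- The reflection principle, proved along the recursion of ballot.
  ballot-closedForm : ∀ r d e → d ≤ r + e → ballot r d e + (d + r) C suc (r + e) ≡ (d + r) C r
  ballot-closedForm zero d e d≤e
    rewrite +-identityʳ d | k>n⇒nCk≡0 (s≤s d≤e) = refl
  ballot-closedForm (suc r) zero e _ = begin
    ballot r 0 (suc e) + suc r C suc (suc r + e)
      ≡⟨ cong (ballot r 0 (suc e) +_) (k>n⇒nCk≡0 (s≤s (s≤s (m≤m+n r e)))) ⟩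
    ballot r 0 (suc e) + 0
      ≡⟨ cong (ballot r 0 (suc e) +_) (k>n⇒nCk≡0 (s≤s (m≤m+n r (suc e)))) ⟨
    ballot r 0 (suc e) + r C suc (r + suc e)
      ≡⟨ ballot-closedForm r 0 (suc e) z≤n ⟩
    r C r
      ≡⟨ trans (nCn≡1 r) (sym (nCn≡1 (suc r))) ⟩
    suc r C suc r ∎
    where open ≡-Reasoning
  ballot-closedForm (suc r) (suc d) zero d<r+0 = begin
    ballot r (suc d) 1 + (suc d + suc r) C suc (suc r + 0)
      ≡⟨ cong₂ (λ N k → ballot r (suc d) 1 + N C suc k) (cong suc (+-suc d r)) (+-identityʳ (suc r)) ⟩
    ballot r (suc d) 1 + suc M C suc (suc r)
      ≡⟨ cong (ballot r (suc d) 1 +_) (pascal M (suc r)) ⟩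
    ballot r (suc d) 1 + (M C suc r + M C suc (suc r))
      ≡⟨ rotate (ballot r (suc d) 1) (M C suc r) (M C suc (suc r)) ⟩
    (ballot r (suc d) 1 + M C suc (suc r)) + M C suc r
      ≡⟨ cong (_+ M C suc r) ih ⟩
    M C r + M C suc r
      ≡⟨ pascal M r ⟨
    suc M C suc r
      ≡⟨ cong (λ N → suc N C suc r) (+-suc d r) ⟨
    (suc d + suc r) C suc r ∎
    where
    open ≡-Reasoning
    M : ℕ
    M = suc (d + r)
    ih : ballot r (suc d) 1 + M C suc (suc r) ≡ M C r
    ih = subst (λ k → ballot r (suc d) 1 + M C suc k ≡ M C r) (+-comm r 1)
           (ballot-closedForm r (suc d) 1 (≤-trans d<r+0 (≤-reflexive (trans (+-identityʳ (suc r)) (+-comm 1 r)))))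
  ballot-closedForm (suc r) (suc d) (suc e) d<r+e = begin
    ballot r (suc d) (suc (suc e)) + ballot (suc r) d e + (suc d + suc r) C suc (suc r + suc e)
      ≡⟨ cong (λ N → ballot r (suc d) (suc (suc e)) + ballot (suc r) d e + suc N C suc X) (+-suc d r) ⟩
    ballot r (suc d) (suc (suc e)) + ballot (suc r) d e + suc M C suc X
      ≡⟨ cong (ballot r (suc d) (suc (suc e)) + ballot (suc r) d e +_) (pascal M X) ⟩
    ballot r (suc d) (suc (suc e)) + ballot (suc r) d e + (M C X + M C suc X)
      ≡⟨ interchange (ballot r (suc d) (suc (suc e))) (ballot (suc r) d e) (M C X) (M C suc X) ⟩
    (ballot r (suc d) (suc (suc e)) + M C suc X) + (ballot (suc r) d e + M C X)
      ≡⟨ cong₂ _+_ ih₁ ih₂ ⟩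
    M C r + M C suc r
      ≡⟨ pascal M r ⟨
    suc M C suc r
      ≡⟨ cong (λ N → suc N C suc r) (+-suc d r) ⟨
    (suc d + suc r) C suc r ∎
    where
    open ≡-Reasoning
    M X : ℕ
    M = suc (d + r)
    X = suc (r + suc e)
    ih₁ : ballot r (suc d) (suc (suc e)) + M C suc X ≡ M C r
    ih₁ = subst (λ k → ballot r (suc d) (suc (suc e)) + M C suc k ≡ M C r) (+-suc r (suc e))
            (ballot-closedForm r (suc d) (suc (suc e)) (≤-trans d<r+e (≤-reflexive (sym (+-suc r (suc e))))))
    ih₂ : ballot (suc r) d e + M C X ≡ M C suc r
    ih₂ = subst₂ (λ N k → ballot (suc r) d e + N C k ≡ N C suc r) (+-suc d r) (cong suc (sym (+-suc r e)))
            (ballot-closedForm (suc r) d e (≤-trans (s≤s⁻¹ d<r+e) (≤-reflexive (+-suc r e))))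

module Counting where

  open import Data.Bool.Base using (Bool; true; false; _∧_)
  open import Data.Bool.Properties using (∧-zeroʳ; ∧-identityʳ)
  open import Data.List.Base using (List; _∷_; head)
  open import Data.List.Relation.Unary.Linked using (linked?)
  open import Data.Maybe.Base using (just)
  import Data.Maybe.Properties as Maybe
  open import Data.Nat.Base
  open import Data.Nat.Combinatorics using (_C_; nCk+nC[k+1]≡[n+1]C[k+1])
  open import Data.Nat.Properties
  open import Data.Nat.Tactic.RingSolver using (solve-∀)
  open import Function.Base using (_∘_)
  open import Relation.Binary.PropositionalEquality
  open import Relation.Nullary using (does; yes; no)
  open Indicators
  open OrderedParking
  open Ballot

  -- Admissible continuations of an ordered preference set after a term w, when spaces up to q are
  -- taken: ordered, bounded by L, and parking within the first N spaces of an infinite street.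
  fits : (N L w q : ℕ) → List ℕ → Bool
  fits N L w q as = does (linked? _≤?_ (w ∷ as)) ∧ (maxList as ≤ᵇ L) ∧ (lastSpace q as ≤ᵇ N)

  private
    ∧-shuffle : ∀ a x c y z → (a ∧ x) ∧ ((c ∧ y) ∧ z) ≡ a ∧ (c ∧ (x ∧ (y ∧ z)))
    ∧-shuffle false x     c     y z = refl
    ∧-shuffle true  false c     y z = sym (∧-zeroʳ c)
    ∧-shuffle true  true  false y z = refl
    ∧-shuffle true  true  true  y z = refl

  fits-∷ : ∀ N L w q b bs → fits N L w q (b ∷ bs) ≡ (w ≤ᵇ b) ∧ (b ≤ᵇ L) ∧ fits N L b (b ⊔ suc q) bs
  fits-∷ N L w q b bs rewrite ⊔-≤ᵇ b (maxList bs) L =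
    ∧-shuffle (w ≤ᵇ b) (does (linked? _≤?_ (b ∷ bs))) (b ≤ᵇ L) (maxList bs ≤ᵇ L)
              (lastSpace (b ⊔ suc q) bs ≤ᵇ N)

  module _ (n N L : ℕ) (L≤n : L ≤ n) where

    count-fits-step : ∀ r w q → 1 ≤ w → w ≤ L → w ≤ q →
      ∑between n w L (λ b → 𝟙 (b ⊔ suc q + r ≤ᵇ N) * ballot r (L ∸ b) (suc N ∸ r ∸ b))
        ≡ 𝟙 (q + suc r ≤ᵇ N) * ballot (suc r) (L ∸ w) (N ∸ r ∸ w)
    count-fits-step r w q 1≤w w≤L w≤q with suc q + r ≤? N
    ... | yes q+r<N rewrite ≤ᵇ-true (≤-trans (≤-reflexive (+-suc q r)) q+r<N) = begin
      ∑between n w L (λ b → 𝟙 (b ⊔ suc q + r ≤ᵇ N) * ballot r (L ∸ b) (suc N ∸ r ∸ b))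
        ≡⟨ ∑between-cong n w L (λ b _ _ → cong₂ (λ x y → 𝟙 x * ballot r (L ∸ b) (y ∸ b))
                                                (⊔-+-≤ᵇ b (suc q) r N q+r<N) N+1-r≡1+N-r) ⟩
      ∑between n w L (λ b → 𝟙 (b ≤ᵇ N ∸ r) * ballot r (L ∸ b) (suc (N ∸ r) ∸ b))
        ≡⟨ ballot-firstStep n r L (N ∸ r) L≤n w 1≤w w≤L
             (m+n≤o⇒m≤o∸n w (≤-trans (+-monoˡ-≤ r (m≤n⇒m≤1+n w≤q)) q+r<N)) ⟩
      ballot (suc r) (L ∸ w) (N ∸ r ∸ w)
        ≡⟨ *-identityˡ _ ⟨
      1 * ballot (suc r) (L ∸ w) (N ∸ r ∸ w) ∎
      where
      open ≡-Reasoning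
      N+1-r≡1+N-r : suc N ∸ r ≡ suc (N ∸ r)
      N+1-r≡1+N-r = +-∸-assoc 1 (m+n≤o⇒n≤o (suc q) q+r<N)
    ... | no q+r≮N
      rewrite ≤ᵇ-false {q + suc r} {N} (≤-trans (≰⇒> q+r≮N) (≤-reflexive (sym (+-suc q r)))) =
      ∑between-zero n w L overfull
      where
      overfull : ∀ b → w ≤ b → b ≤ L → 𝟙 (b ⊔ suc q + r ≤ᵇ N) * ballot r (L ∸ b) (suc N ∸ r ∸ b) ≡ 0
      overfull b _ _ rewrite ≤ᵇ-false (<-≤-trans (≰⇒> q+r≮N) (+-monoˡ-≤ r (m≤n⊔m b (suc q)))) = refl

    count-fits : ∀ r w q → 1 ≤ w → w ≤ L → w ≤ q →
                 ∑ (λ as → 𝟙 (fits N L w q as)) (prefSeqs n r)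
                   ≡ 𝟙 (q + r ≤ᵇ N) * ballot r (L ∸ w) (suc N ∸ r ∸ w)
    count-fits zero w q _ _ _ rewrite +-identityʳ q = trans (+-identityʳ _) (sym (*-identityʳ _))
    count-fits (suc r) w q 1≤w w≤L w≤q = begin
      ∑ (λ as → 𝟙 (fits N L w q as)) (prefSeqs n (suc r))
        ≡⟨ ∑-prefSeqs-suc n r (λ as → 𝟙 (fits N L w q as)) ⟩
      ∑₁ n (λ b → ∑ (λ bs → 𝟙 (fits N L w q (b ∷ bs))) P)
        ≡⟨ ∑₁-cong n (λ i → first (suc i)) ⟩
      ∑between n w L (λ b → ∑ (λ bs → 𝟙 (fits N L b (b ⊔ suc q) bs)) P)
        ≡⟨ ∑between-cong n w L (λ b w≤b b≤L →
             count-fits r b (b ⊔ suc q) (≤-trans 1≤w w≤b) b≤L (m≤m⊔n b (suc q))) ⟩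
      ∑between n w L (λ b → 𝟙 (b ⊔ suc q + r ≤ᵇ N) * ballot r (L ∸ b) (suc N ∸ r ∸ b))
        ≡⟨ count-fits-step r w q 1≤w w≤L w≤q ⟩
      𝟙 (q + suc r ≤ᵇ N) * ballot (suc r) (L ∸ w) (N ∸ r ∸ w) ∎
      where
      open ≡-Reasoning
      P : List (List ℕ)
      P = prefSeqs n r
      first : ∀ b → ∑ (λ bs → 𝟙 (fits N L w q (b ∷ bs))) P
                    ≡ 𝟙 (w ≤ᵇ b) * (𝟙 (b ≤ᵇ L) * ∑ (λ bs → 𝟙 (fits N L b (b ⊔ suc q) bs)) P)
      first b = begin
        ∑ (λ bs → 𝟙 (fits N L w q (b ∷ bs))) P
          ≡⟨ ∑-cong (λ bs → trans (cong 𝟙 (fits-∷ N L w q b bs))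
                                  (trans (𝟙-∧ (w ≤ᵇ b) _) (cong (𝟙 (w ≤ᵇ b) *_) (𝟙-∧ (b ≤ᵇ L) _)))) P ⟩
        ∑ (λ bs → 𝟙 (w ≤ᵇ b) * (𝟙 (b ≤ᵇ L) * 𝟙 (fits N L b (b ⊔ suc q) bs))) P
          ≡⟨ *-distribˡ-∑ (𝟙 (w ≤ᵇ b)) _ P ⟨
        𝟙 (w ≤ᵇ b) * ∑ (λ bs → 𝟙 (b ≤ᵇ L) * 𝟙 (fits N L b (b ⊔ suc q) bs)) P
          ≡⟨ cong (𝟙 (w ≤ᵇ b) *_) (*-distribˡ-∑ (𝟙 (b ≤ᵇ L)) _ P) ⟨
        𝟙 (w ≤ᵇ b) * (𝟙 (b ≤ᵇ L) * ∑ (λ bs → 𝟙 (fits N L b (b ⊔ suc q) bs)) P) ∎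

  atMost : (n h m L : ℕ) → List ℕ → Bool
  atMost n h m L as = does (linked? _≤?_ as) ∧ (flaws n as ≤ᵇ h)
                      ∧ does (Maybe.≡-dec _≟_ (head as) (just m)) ∧ (maxList as ≤ᵇ L)

  opAtMost : ℕ → ℕ → ℕ → ℕ → ℕ
  opAtMost n h m L = ∑ (λ as → 𝟙 (atMost n h m L as)) (prefSets n)

  -- At most h flaws means fitting on a street of n + h spaces (flaws-ordered).
  atMost-∷ : ∀ n h m L a as → m ≤ L → L ≤ n → atMost n h m L (a ∷ as) ≡ (m ≡ᵇ a) ∧ fits (n + h) L m m as
  atMost-∷ n h m L a as m≤L L≤n with a ≟ m
  ... | no a≢m rewrite ≡ᵇ-false a≢m | ≡ᵇ-false (a≢m ∘ sym) =
    trans (cong (does (linked? _≤?_ (a ∷ as)) ∧_) (∧-zeroʳ _)) (∧-zeroʳ _)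
  ... | yes refl rewrite ≡ᵇ-true (refl {x = a}) | ⊔-≤ᵇ a (maxList as) L | ≤ᵇ-true m≤L
    with linked? _≤?_ (a ∷ as) | maxList as ≤? L
  ...   | no _       | _ = refl
  ...   | yes _      | no max≰L rewrite ≤ᵇ-false (≰⇒> max≰L) = ∧-zeroʳ _
  ...   | yes sorted | yes max≤L
    rewrite ≤ᵇ-true max≤L | flaws-ordered n a as (≤-trans m≤L L≤n) sorted (≤-trans max≤L L≤n) =
    trans (∧-identityʳ _) (∸-≤ᵇ (lastSpace a as) n h)

  count-atMost : ∀ n h m L → 1 ≤ m → m ≤ L → L ≤ suc n → m ≤ suc h →
    opAtMost (suc n) h m L ≡ ballot n (L ∸ m) (suc (suc h) ∸ m)
  count-atMost n h m L 1≤m m≤L L≤n m≤h+1 = begin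
    ∑ (λ as → 𝟙 (atMost (suc n) h m L as)) (prefSeqs (suc n) (suc n))
      ≡⟨ ∑-prefSeqs-suc (suc n) n (λ as → 𝟙 (atMost (suc n) h m L as)) ⟩
    ∑₁ (suc n) startingWith
      ≡⟨ ∑₁-cong (suc n) {startingWith} {λ a → 𝟙 (m ≡ᵇ a) * continuations} (λ i → headed (suc i)) ⟩
    ∑₁ (suc n) (λ a → 𝟙 (m ≡ᵇ a) * continuations)
      ≡⟨ ∑₁-pointMass (suc n) m (λ _ → continuations) 1≤m (≤-trans m≤L L≤n) ⟩
    continuations
      ≡⟨ count-fits (suc n) N L L≤n n m m 1≤m m≤L ≤-refl ⟩
    𝟙 (m + n ≤ᵇ N) * ballot n (L ∸ m) (suc N ∸ n ∸ m)
      ≡⟨ cong₂ (λ x y → 𝟙 x * ballot n (L ∸ m) (y ∸ m)) (≤ᵇ-true m+n≤N) N+1-n≡h+2 ⟩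
    1 * ballot n (L ∸ m) (suc (suc h) ∸ m)
      ≡⟨ *-identityˡ _ ⟩
    ballot n (L ∸ m) (suc (suc h) ∸ m) ∎
    where
    open ≡-Reasoning
    N : ℕ
    N = suc n + h
    P : List (List ℕ)
    P = prefSeqs (suc n) n
    startingWith : ℕ → ℕ
    startingWith a = ∑ (λ as → 𝟙 (atMost (suc n) h m L (a ∷ as))) P
    continuations : ℕ
    continuations = ∑ (λ as → 𝟙 (fits N L m m as)) P
    headed : ∀ a → startingWith a ≡ 𝟙 (m ≡ᵇ a) * continuations
    headed a = trans (∑-cong (λ as → trans (cong 𝟙 (atMost-∷ (suc n) h m L a as m≤L L≤n)) (𝟙-∧ (m ≡ᵇ a) _)) P)
                     (sym (*-distribˡ-∑ (𝟙 (m ≡ᵇ a)) _ P))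
    m+n≤N : m + n ≤ N
    m+n≤N = ≤-trans (+-monoˡ-≤ n m≤h+1) (≤-reflexive (cong suc (+-comm h n)))
    N+1-n≡h+2 : suc N ∸ n ≡ suc (suc h)
    N+1-n≡h+2 = trans (cong (_∸ n) (sym (trans (+-suc n (suc h)) (cong suc (+-suc n h)))))
                      (m+n∸m≡n n (suc (suc h)))

  private
    𝟙-∧₄ : ∀ a b c d → 𝟙 (a ∧ b ∧ c ∧ d) ≡ 𝟙 a * (𝟙 b * (𝟙 c * 𝟙 d))
    𝟙-∧₄ a b c d = trans (𝟙-∧ a _) (cong (𝟙 a *_) (trans (𝟙-∧ b _) (cong (𝟙 b *_) (𝟙-∧ c d))))

    inclusion–exclusion : ∀ s e a h x y →
      s * (e * (h * x)) + s * (a * (h * (x + y))) + s * ((e + a) * (h * y))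
        ≡ s * ((e + a) * (h * (x + y))) + s * (a * (h * y))
    inclusion–exclusion = solve-∀

    indicator-inclusion–exclusion : ∀ S F H M k l →
      𝟙 (S ∧ (F ≡ᵇ suc k) ∧ H ∧ (M ≡ᵇ suc l)) + 𝟙 (S ∧ (F ≤ᵇ k) ∧ H ∧ (M ≤ᵇ suc l))
        + 𝟙 (S ∧ (F ≤ᵇ suc k) ∧ H ∧ (M ≤ᵇ l))
        ≡ 𝟙 (S ∧ (F ≤ᵇ suc k) ∧ H ∧ (M ≤ᵇ suc l)) + 𝟙 (S ∧ (F ≤ᵇ k) ∧ H ∧ (M ≤ᵇ l))
    indicator-inclusion–exclusion S F H M k l
      rewrite 𝟙-∧₄ S (F ≡ᵇ suc k) H (M ≡ᵇ suc l) | 𝟙-∧₄ S (F ≤ᵇ k) H (M ≤ᵇ suc l)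
            | 𝟙-∧₄ S (F ≤ᵇ suc k) H (M ≤ᵇ l) | 𝟙-∧₄ S (F ≤ᵇ suc k) H (M ≤ᵇ suc l)
            | 𝟙-∧₄ S (F ≤ᵇ k) H (M ≤ᵇ l) | 𝟙-≤ᵇ-suc F k | 𝟙-≤ᵇ-suc M l =
      inclusion–exclusion (𝟙 S) (𝟙 (F ≡ᵇ suc k)) (𝟙 (F ≤ᵇ k)) (𝟙 H) (𝟙 (M ≡ᵇ suc l)) (𝟙 (M ≤ᵇ l))

  exactly+atMost≡atMost+atMost : ∀ n k m l as →
    𝟙 (does (counted? n (suc k) m (suc l) as)) + 𝟙 (atMost n k m (suc l) as) + 𝟙 (atMost n (suc k) m l as)
      ≡ 𝟙 (atMost n (suc k) m (suc l) as) + 𝟙 (atMost n k m l as)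
  exactly+atMost≡atMost+atMost n k m l as = indicator-inclusion–exclusion
    (does (linked? _≤?_ as)) (flaws n as) (does (Maybe.≡-dec _≟_ (head as) (just m))) (maxList as) k l

  private
    cancel : ∀ E D₁ D₂ D₃ D₄ N₁ N₂ x y c → E + D₂ + D₃ ≡ D₁ + D₄ →
             D₁ + (y + c) ≡ N₁ → D₂ + (x + y) ≡ N₁ → D₃ + c ≡ N₂ → D₄ + y ≡ N₂ → E + y ≡ x
    cancel E D₁ D₂ D₃ D₄ N₁ N₂ x y c split e₁ e₂ e₃ e₄ = +-cancelʳ-≡ (D₂ + D₃ + y + c) (E + y) x (begin
      E + y + (D₂ + D₃ + y + c)          ≡⟨ regroup₁ E D₂ D₃ y c ⟩
      (E + D₂ + D₃) + (y + c + y)       ≡⟨ cong (_+ (y + c + y)) split ⟩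
      (D₁ + D₄) + (y + c + y)            ≡⟨ regroup₂ D₁ D₄ y c ⟩
      (D₁ + (y + c)) + (D₄ + y)          ≡⟨ cong₂ _+_ (trans e₁ (sym e₂)) (trans e₄ (sym e₃)) ⟩
      (D₂ + (x + y)) + (D₃ + c)          ≡⟨ regroup₃ D₂ D₃ x y c ⟩
      x + (D₂ + D₃ + y + c)              ∎)
      where
      open ≡-Reasoning
      regroup₁ : ∀ E D₂ D₃ y c → E + y + (D₂ + D₃ + y + c) ≡ (E + D₂ + D₃) + (y + c + y)
      regroup₁ = solve-∀
      regroup₂ : ∀ D₁ D₄ y c → (D₁ + D₄) + (y + c + y) ≡ (D₁ + (y + c)) + (D₄ + y)
      regroup₂ = solve-∀
      regroup₃ : ∀ D₂ D₃ x y c → (D₂ + (x + y)) + (D₃ + c) ≡ x + (D₂ + D₃ + y + c)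
      regroup₃ = solve-∀

  op+opAtMost≡opAtMost+opAtMost : ∀ n k m l →
    op n (suc k) m (suc l) + opAtMost n k m (suc l) + opAtMost n (suc k) m l
      ≡ opAtMost n (suc k) m (suc l) + opAtMost n k m l
  op+opAtMost≡opAtMost+opAtMost n k m l = begin
    op n (suc k) m (suc l) + opAtMost n k m (suc l) + opAtMost n (suc k) m l
      ≡⟨ cong (λ x → x + opAtMost n k m (suc l) + opAtMost n (suc k) m l)
              (length-filter≡∑𝟙 (counted? n (suc k) m (suc l)) P) ⟩
    ∑ exactly P + ∑ (atMost′ k (suc l)) P + ∑ (atMost′ (suc k) l) P
      ≡⟨ cong (_+ ∑ (atMost′ (suc k) l) P) (∑-distrib-+ exactly (atMost′ k (suc l)) P) ⟨
    ∑ (λ as → exactly as + atMost′ k (suc l) as) P + ∑ (atMost′ (suc k) l) P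
      ≡⟨ ∑-distrib-+ _ (atMost′ (suc k) l) P ⟨
    ∑ (λ as → exactly as + atMost′ k (suc l) as + atMost′ (suc k) l as) P
      ≡⟨ ∑-cong (exactly+atMost≡atMost+atMost n k m l) P ⟩
    ∑ (λ as → atMost′ (suc k) (suc l) as + atMost′ k l as) P
      ≡⟨ ∑-distrib-+ (atMost′ (suc k) (suc l)) (atMost′ k l) P ⟩
    opAtMost n (suc k) m (suc l) + opAtMost n k m l ∎
    where
    open ≡-Reasoning
    P : List (List ℕ)
    P = prefSets n
    exactly : List ℕ → ℕ
    exactly as = 𝟙 (does (counted? n (suc k) m (suc l) as))
    atMost′ : ℕ → ℕ → List ℕ → ℕ
    atMost′ h L as = 𝟙 (atMost n h m L as)

  opAtMost-closedForm : ∀ r m h L d e → h ≡ m + e → L ≡ suc m + d → L ≤ suc r → d ≤ r + suc e →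
                        opAtMost (suc r) h (suc m) L + (d + r) C suc (r + suc e) ≡ (d + r) C r
  opAtMost-closedForm r m _ _ d e refl refl L≤n d≤r+e+1 = begin
    opAtMost (suc r) (m + e) (suc m) (suc m + d) + (d + r) C suc (r + suc e)
      ≡⟨ cong (_+ (d + r) C suc (r + suc e))
              (count-atMost r (m + e) (suc m) (suc m + d) (s≤s z≤n) (m≤m+n (suc m) d) L≤n (s≤s (m≤m+n m e))) ⟩
    ballot r (suc m + d ∸ suc m) (suc (suc (m + e)) ∸ suc m) + (d + r) C suc (r + suc e)
      ≡⟨ cong₂ (λ d′ e′ → ballot r d′ e′ + (d + r) C suc (r + suc e))
               (m+n∸m≡n (suc m) d) (trans (cong (_∸ m) (sym (+-suc m e))) (m+n∸m≡n m (suc e))) ⟩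
    ballot r d (suc e) + (d + r) C suc (r + suc e)
      ≡⟨ ballot-closedForm r d (suc e) d≤r+e+1 ⟩
    (d + r) C r ∎
    where open ≡-Reasoning

  -- op is a mixed second difference of opAtMost in the flaw bound and the maximum: the leading
  -- binomials C(d + r, r) of the closed forms cancel and Pascal's rule merges the rest.
  op-binomialDifference : ∀ r m t o → 1 ≤ m → m + t + o ≤ r →
    op (suc r) (m + t) m (suc (m + t + o)) + (t + o + r) C suc (r + suc t) ≡ (t + o + r) C (r + suc t)
  op-binomialDifference r (suc m) t o _ l≤r =
    cancel (op (suc r) (suc k) (suc m) (suc l)) (D (suc k) (suc l)) (D k (suc l)) (D (suc k) l) (D k l)
           (suc Z C r) (Z C r) (Z C p) (Z C suc p) (Z C suc (suc p))
           (op+opAtMost≡opAtMost+opAtMost (suc r) k (suc m) l)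
           (trans (cong (D (suc k) (suc l) +_) (nCk+nC[k+1]≡[n+1]C[k+1] Z (suc p)))
                  (subst (λ i → D (suc k) (suc l) + suc Z C suc i ≡ suc Z C r) (+-suc r (suc t))
                         (closedForm (suc k) (suc l) (suc (t + o)) (suc t) k+1≡m+t+1 l+1≡m+t+o+1 (s≤s l≤r) t+o<r+t+1)))
           (trans (cong (D k (suc l) +_) (nCk+nC[k+1]≡[n+1]C[k+1] Z p))
                  (closedForm k (suc l) (suc (t + o)) t refl l+1≡m+t+o+1 (s≤s l≤r) (≤-trans t+o<r (m≤m+n r _))))
           (subst (λ i → D (suc k) l + Z C suc i ≡ Z C r) (+-suc r (suc t))
                  (closedForm (suc k) l (t + o) (suc t) k+1≡m+t+1 l≡m+t+o (m≤n⇒m≤1+n l≤r) (<⇒≤ t+o<r+t+1)))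
           (closedForm k l (t + o) t refl l≡m+t+o (m≤n⇒m≤1+n l≤r) (<⇒≤ (≤-trans t+o<r (m≤m+n r _))))
    where
    k l Z p : ℕ
    k = m + t
    l = suc m + t + o
    Z = t + o + r
    p = r + suc t
    D : ℕ → ℕ → ℕ
    D h L = opAtMost (suc r) h (suc m) L
    closedForm : ∀ h L d e → h ≡ m + e → L ≡ suc m + d → L ≤ suc r → d ≤ r + suc e →
                 D h L + (d + r) C suc (r + suc e) ≡ (d + r) C r
    closedForm = opAtMost-closedForm r m
    k+1≡m+t+1 : suc k ≡ m + suc t
    k+1≡m+t+1 = sym (+-suc m t)
    l≡m+t+o : l ≡ suc m + (t + o)
    l≡m+t+o = cong suc (+-assoc m t o)
    l+1≡m+t+o+1 : suc l ≡ suc m + suc (t + o)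
    l+1≡m+t+o+1 = cong suc (trans l≡m+t+o (sym (+-suc m (t + o))))
    t+o<r : suc (t + o) ≤ r
    t+o<r = ≤-trans (s≤s (≤-trans (m≤n+m (t + o) m) (≤-reflexive (sym (+-assoc m t o))))) l≤r
    t+o<r+t+1 : suc (t + o) ≤ r + suc (suc t)
    t+o<r+t+1 = ≤-trans t+o<r (m≤m+n r _)

module BallotNumbers where

  open import Data.Integer.Base using (ℤ; +_; -[1+_]; _+_; _-_; _*_)
  import Data.Integer.Properties as ℤ
  import Data.Integer.Tactic.RingSolver as ℤ-Solver
  open import Data.Nat.Base as N using (ℕ; _≤_; _∸_)
  import Data.Nat.Properties as N
  import Data.Nat.Tactic.RingSolver as ℕ-Solver
  open import Data.Nat.Combinatorics using (_C_; nCk≡nC[n∸k]; k>n⇒nCk≡0)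
  open import Data.Product.Base using (_,_)
  open import Relation.Binary.PropositionalEquality
  open Binomial using (pascal; [1+t]*[t+b]C[1+t]≡b*[t+b]Ct)
  open Counting using (op-binomialDifference)

  pos-∸ : ∀ a c d → a ≡ c N.+ d → + a - + d ≡ + c
  pos-∸ a c d a≡c+d = begin
    + a - + d            ≡⟨ cong (λ z → + z - + d) a≡c+d ⟩
    + (c N.+ d) - + d    ≡⟨ cong (_- + d) (ℤ.pos-+ c d) ⟩
    + c + + d - + d      ≡⟨ cancel (+ c) (+ d) ⟩
    + c                  ∎
    where
    open ≡-Reasoning
    cancel : ∀ x y → x + y - y ≡ x
    cancel = ℤ-Solver.solve-∀

  difference⇒ballotNumber : ∀ p b o → o N.+ (p N.+ b) C N.suc p ≡ (p N.+ b) C p →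
                            + o * (+ p + + b + + 1) ≡ (+ p + + 1 - + b) * + (N.suc (p N.+ b) C b)
  difference⇒ballotNumber p b o o+y≡x = begin
    + o * (+ p + + b + + 1)
      ≡⟨ cong (_* (+ p + + b + + 1)) (sym (pos-∸ x o y (sym o+y≡x))) ⟩
    (+ x - + y) * (+ p + + b + + 1)
      ≡⟨ regroup (+ p) (+ b) (+ x) (+ y) ⟩
    (+ p + + 1 - + b) * (+ x + + y) + + 2 * (+ b * + x - (+ 1 + + p) * + y)
      ≡⟨ cong (λ z → (+ p + + 1 - + b) * (+ x + + y) + + 2 * (+ b * + x - z)) absorption ⟩
    (+ p + + 1 - + b) * (+ x + + y) + + 2 * (+ b * + x - + b * + x)
      ≡⟨ vanish ((+ p + + 1 - + b) * (+ x + + y)) (+ b * + x) ⟩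
    (+ p + + 1 - + b) * (+ x + + y)
      ≡⟨ cong ((+ p + + 1 - + b) *_) (trans (cong +_ symmetry) (ℤ.pos-+ x y)) ⟨
    (+ p + + 1 - + b) * + (N.suc (p N.+ b) C b) ∎
    where
    open ≡-Reasoning
    x y : ℕ
    x = (p N.+ b) C p
    y = (p N.+ b) C N.suc p
    regroup : ∀ p b x y → (x - y) * (p + b + + 1) ≡ (p + + 1 - b) * (x + y) + + 2 * (b * x - (+ 1 + p) * y)
    regroup = ℤ-Solver.solve-∀
    vanish : ∀ a c → a + + 2 * (c - c) ≡ a
    vanish = ℤ-Solver.solve-∀
    absorption : (+ 1 + + p) * + y ≡ + b * + x
    absorption = trans (sym (ℤ.pos-* (N.suc p) y))
                       (trans (cong +_ ([1+t]*[t+b]C[1+t]≡b*[t+b]Ct p b)) (ℤ.pos-* b x))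
    symmetry : N.suc (p N.+ b) C b ≡ x N.+ y
    symmetry = trans (nCk≡nC[n∸k] (N.≤-trans (N.m≤n+m b p) (N.n≤1+n (p N.+ b))))
                     (trans (cong (N.suc (p N.+ b) C_) (N.m+n∸n≡m (N.suc p) b)) (pascal (p N.+ b) p))

  op-ballotNumber-offsets : ∀ r m t o → 1 ≤ m → m N.+ t N.+ o ≤ r →
    + op (N.suc r) (m N.+ t) m (N.suc (m N.+ t N.+ o)) * (+ (r N.+ N.suc t) + (+ o - + 1) + + 1)
      ≡ (+ (r N.+ N.suc t) + + 1 - (+ o - + 1)) * binomℤ (r N.+ N.suc t N.+ o) (+ o - + 1)
  -- For o = 0 the lower index is -1, where binomℤ is 0, and op vanishes too.
  op-ballotNumber-offsets r m t N.zero 1≤m l≤n =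
    trans (cong (λ z → + z * (+ (r N.+ N.suc t) + -[1+ 0 ] + + 1)) op≡0)
          (sym (ℤ.*-zeroʳ (+ (r N.+ N.suc t) + + 1 - -[1+ 0 ])))
    where
    op≡0 : op (N.suc r) (m N.+ t) m (N.suc (m N.+ t N.+ 0)) ≡ 0
    op≡0 = N.m+n≡0⇒m≡0 _ (trans (op-binomialDifference r m t 0 1≤m l≤n)
                                (k>n⇒nCk≡0 (N.≤-reflexive (regroup t r))))
      where
      regroup : ∀ t r → N.suc (t N.+ 0 N.+ r) ≡ r N.+ N.suc t
      regroup = ℕ-Solver.solve-∀
  op-ballotNumber-offsets r m t (N.suc b) 1≤m l≤n
    rewrite N.+-suc (r N.+ N.suc t) b = difference⇒ballotNumber p b _ difference
    where
    p : ℕ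
    p = r N.+ N.suc t
    exact : ℕ
    exact = op (N.suc r) (m N.+ t) m (N.suc (m N.+ t N.+ N.suc b))
    difference : exact N.+ (p N.+ b) C N.suc p ≡ (p N.+ b) C p
    difference = subst (λ z → exact N.+ z C N.suc p ≡ z C p)
                       (regroup t b r) (op-binomialDifference r m t (N.suc b) 1≤m l≤n)
      where
      regroup : ∀ t b r → t N.+ N.suc b N.+ r ≡ r N.+ N.suc t N.+ b
      regroup = ℕ-Solver.solve-∀

  op-ballotNumber : ∀ n k m l → 1 ≤ m → m ≤ k → N.suc k ≤ l → l ≤ n →
    + op n k m l * ((+ n - + m + + k) + (+ l - + k - + 2) + + 1)
      ≡ ((+ n - + m + + k) + + 1 - (+ l - + k - + 2)) * binomℤ (n N.+ l ∸ m ∸ 1) (+ l - + k - + 2)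
  op-ballotNumber _ _ m _ 1≤m m≤k k<l l≤n with N.m≤n⇒∃[o]m+o≡n m≤k
  ... | t , refl with N.m≤n⇒∃[o]m+o≡n k<l
  ... | o , refl with N.m≤n⇒∃[o]m+o≡n l≤n
  ... | s , refl = transport {o = + op (N.suc r) (m N.+ t) m (N.suc (m N.+ t N.+ o))} p≡n-m+k index n+l-m-1≡p+o
                     (op-ballotNumber-offsets r m t o 1≤m (N.m≤m+n (m N.+ t N.+ o) s))
    where
    r : ℕ
    r = m N.+ t N.+ o N.+ s
    transport : ∀ {o P P′ B B′ A A′} → P ≡ P′ → B ≡ B′ → A ≡ A′ →
                o * (P′ + B′ + + 1) ≡ (P′ + + 1 - B′) * binomℤ A′ B′ →
                o * (P + B + + 1) ≡ (P + + 1 - B) * binomℤ A B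
    transport refl refl refl formula = formula
    p≡n-m+k : + N.suc r - + m + + (m N.+ t) ≡ + (r N.+ N.suc t)
    p≡n-m+k = trans (swap (+ N.suc r) (+ m) (+ (m N.+ t)))
                    (trans (cong (_- + m) (sym (ℤ.pos-+ (N.suc r) (m N.+ t))))
                           (pos-∸ (N.suc r N.+ (m N.+ t)) (r N.+ N.suc t) m (regroup m t o s)))
      where
      swap : ∀ x y z → x - y + z ≡ x + z - y
      swap = ℤ-Solver.solve-∀
      regroup : ∀ m t o s → N.suc (m N.+ t N.+ o N.+ s) N.+ (m N.+ t) ≡ m N.+ t N.+ o N.+ s N.+ N.suc t N.+ m
      regroup = ℕ-Solver.solve-∀
    index : + (N.suc (m N.+ t) N.+ o) - + (m N.+ t) - + 2 ≡ + o - + 1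
    index = trans (cong (λ z → z - + (m N.+ t) - + 2) (ℤ.pos-+ (N.suc (m N.+ t)) o))
                  (simplify (+ (m N.+ t)) (+ o))
      where
      simplify : ∀ x y → + 1 + x + y - x - + 2 ≡ y - + 1
      simplify = ℤ-Solver.solve-∀
    n+l-m-1≡p+o : N.suc r N.+ N.suc (m N.+ t N.+ o) ∸ m ∸ 1 ≡ r N.+ N.suc t N.+ o
    n+l-m-1≡p+o = cong (_∸ 1) (trans (cong (_∸ m) (regroup m t o s)) (N.m+n∸m≡n m _))
      where
      regroup : ∀ m t o s → N.suc (m N.+ t N.+ o N.+ s) N.+ N.suc (m N.+ t N.+ o)
                            ≡ m N.+ N.suc (m N.+ t N.+ o N.+ s N.+ N.suc t N.+ o)
      regroup = ℕ-Solver.solve-∀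

  -- With p = n - m + k and b = l - k - 2, the paper's numerator factor is (p + 2) (p + 1 - b).
  toPaperForm : ∀ (n m k l o c : ℤ) →
    o * ((n - m + k) + (l - k - + 2) + + 1) ≡ ((n - m + k) + + 1 - (l - k - + 2)) * c →
    o * ((n - m + k + + 2) * (n + l - m - + 1))
      ≡ ((n - l + + 2 * k - m + + 4) * (n - m + k + + 1) - (l - k - + 2)) * c
  toPaperForm n m k l o c formula = begin
    o * ((n - m + k + + 2) * (n + l - m - + 1))
      ≡⟨ expose n m k l o ⟩
    (n - m + k + + 2) * (o * ((n - m + k) + (l - k - + 2) + + 1))
      ≡⟨ cong ((n - m + k + + 2) *_) formula ⟩
    (n - m + k + + 2) * (((n - m + k) + + 1 - (l - k - + 2)) * c)
      ≡⟨ expand n m k l c ⟩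
    ((n - l + + 2 * k - m + + 4) * (n - m + k + + 1) - (l - k - + 2)) * c ∎
    where
    open ≡-Reasoning
    expose : ∀ n m k l o → o * ((n - m + k + + 2) * (n + l - m - + 1))
                           ≡ (n - m + k + + 2) * (o * ((n - m + k) + (l - k - + 2) + + 1))
    expose = ℤ-Solver.solve-∀
    expand : ∀ n m k l c → (n - m + k + + 2) * (((n - m + k) + + 1 - (l - k - + 2)) * c)
                           ≡ ((n - l + + 2 * k - m + + 4) * (n - m + k + + 1) - (l - k - + 2)) * c
    expand = ℤ-Solver.solve-∀

open import Data.Nat using (ℕ; _≤_; _∸_)
open import Data.Integer using (+_; _-_; _*_)
open import Relation.Binary.PropositionalEquality using (_≡_)
import Data.Nat as N
import Data.Integer as Z
open BallotNumbers using (op-ballotNumber; toPaperForm)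

mainTheorem8 : (n k m l : ℕ) → 1 ≤ m → m ≤ k → N.suc k ≤ l → l ≤ n →
    (+ op n k m l) * ((+ n - + m Z.+ + k Z.+ + 2) * (+ n Z.+ + l - + m - + 1))
      ≡ ((+ n - + l Z.+ + 2 * + k - + m Z.+ + 4) * (+ n - + m Z.+ + k Z.+ + 1) - (+ l - + k - + 2))
        * binomℤ (n N.+ l ∸ m ∸ 1) (+ l - + k - + 2)
mainTheorem8 n k m l 1≤m m≤k k<l l≤n =
  toPaperForm (+ n) (+ m) (+ k) (+ l) (+ op n k m l) (binomℤ (n N.+ l ∸ m ∸ 1) (+ l - + k - + 2))
    (op-ballotNumber n k m l 1≤m m≤k k<l l≤n)
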